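{- Let $H$ be a sequence of moves of length $m$, let $P\subseteq[m]$ be a nonempty set of indices, and let $C$ be a nonempty set of arcs of $H$ such that $\mathrm{len}(\alpha)\le\ell$ for all $\alpha\in C$, for some positive integer $\ell\le m/2$. Then there exists an interval $I=[i:i+2\ell-1]\subseteq[m]$ of length $2\ell$ such that $$\frac{|C|_I|}{|C|}\ge\max\left\{\frac{2\ell}{16m},\ \frac{|P\cap I|}{4|P|}\right\}.$$ Thus $\dfrac{|C|_I|}{\mathrm{len}(I)}\ge\Omega\!\left(\dfrac{|C|}{\mathrm{len}(H)}\right)$ and $\dfrac{|C|_I|}{|P\cap I|}\ge\Omega\!\left(\dfrac{|C|}{|P|}\right)$.
   Context: For a sequence $H=(\sigma_1,\dots,\sigma_m)$, an arc is a pair $\alpha=(i,j)$ with $i<j$, $\sigma_i=\sigma_j$, $\sigma_l\ne\sigma_i$ for $i<l<j$; $\mathrm{len}(\alpha)=j-i+1$. $[i:j]=\{i,\dots,j\}$ and $\mathrm{len}([i:j])=j-i+1$. An arc $(i,j)$ is contained in an interval $I$ if $i,j\in I$, and $C|_I$ denotes the set of arcs of $C$ contained in $I$. -}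

module Defs where

open import Level using (Level)
open import Data.Nat using (ℕ; _+_; _*_; _≤_; _<_; _≤?_; _<?_)
open import Data.Fin using (Fin; toℕ)
open import Data.Product using (_×_; _,_; proj₁; proj₂)
open import Data.List using (List; filter; length)
open import Relation.Nullary using (¬_; Dec)
open import Relation.Nullary.Decidable using (_×-dec_)
open import Relation.Binary.PropositionalEquality using (_≡_)

-- A sequence H = (σ₁,…,σₘ) is a function Fin m → A; positions are 0-based
-- (position k ∈ Fin m corresponds to the paper's index k+1).

IsArc : ∀ {a} {A : Set a} {m : ℕ} → (Fin m → A) → Fin m × Fin m → Set a
IsArc {m = m} H (i , j) =
  (toℕ i < toℕ j) × (H i ≡ H j) ×
  (∀ (l : Fin m) → toℕ i < toℕ l → toℕ l < toℕ j → ¬ (H l ≡ H i))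

-- len(α) = j - i + 1, i.e. len((i,j)) = toℕ j + 1 - toℕ i (here i < j).
-- We express "len(α) ≤ ℓ" as  toℕ j + 1 ≤ toℕ i + ℓ.
ArcLen≤ : {m : ℕ} → Fin m × Fin m → ℕ → Set
ArcLen≤ (i , j) ℓ = toℕ j + 1 ≤ toℕ i + ℓ

InInterval : {m : ℕ} → ℕ → ℕ → Fin m → Set
InInterval s L k = (s ≤ toℕ k) × (toℕ k < s + L)

inInterval? : {m : ℕ} → (s L : ℕ) → (k : Fin m) → Dec (InInterval s L k)
inInterval? s L k = (s ≤? toℕ k) ×-dec (toℕ k <? s + L)

ContainedIn : {m : ℕ} → ℕ → ℕ → Fin m × Fin m → Set
ContainedIn s L (i , j) = InInterval s L i × InInterval s L j

containedIn? : {m : ℕ} → (s L : ℕ) → (α : Fin m × Fin m) → Dec (ContainedIn s L α)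
containedIn? s L (i , j) = inInterval? s L i ×-dec inInterval? s L j

countContained : {m : ℕ} → ℕ → ℕ → List (Fin m × Fin m) → ℕ
countContained s L C = length (filter (containedIn? s L) C)

countIn : {m : ℕ} → ℕ → ℕ → List (Fin m) → ℕ
countIn s L P = length (filter (inInterval? s L) P)

module Submission where

-- Write ℓ ≥ 1, q = ⌊m/ℓ⌋ ≥ 2 and consider the q windows Wₖ of length 2ℓ
-- starting at  min (k·ℓ , m − 2ℓ)  for k < q.  Two geometric facts hold:
--   * every arc of length ≤ ℓ lies inside some window, so Σₖ |C|_Wₖ| ≥ |C|;
--   * every position lies in at most three windows, so Σₖ |P ∩ Wₖ| ≤ 3|P|.
-- Since q·2ℓ ≤ 2m, the sum over k of  |P|·2ℓ·|C| + 4m·|C|·|P ∩ Wₖ|  is at most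
-- 14·m·|P|·|C| ≤ Σₖ 16·m·|P|·|C|_Wₖ|, so for some k the k-th summand on the left
-- is bounded by the k-th on the right, and this window satisfies both
-- inequalities of the theorem.

open import Defs
open import Data.Nat using (ℕ; _+_; _*_; _≤_; _<_)
open import Data.Fin using (Fin)
open import Data.Product using (_×_; Σ; _,_)
open import Data.Product using (map₂)
open import Data.List using (List; length; [])
open import Data.List.Relation.Unary.All using (All)
open import Data.List.Relation.Unary.Unique.Propositional using (Unique)
open import Relation.Nullary using (¬_)
open import Relation.Binary.PropositionalEquality using (_≡_)

open import Data.Nat using (zero; suc; _∸_; _⊓_; z≤n; s≤s; z<s; _≟_; _≤?_; _<?_; pred)
open import Data.Nat using (NonZero; >-nonZero; >-nonZero⁻¹)
open import Data.Nat.Properties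
open import Data.Nat.DivMod using (_/_; _%_; m≡m%n+[m/n]*n; m%n<n; m/n*n≤m; m*n/n≡m)
open import Data.Nat.DivMod using (/-monoˡ-≤; m<n*o⇒m/o<n)
open import Data.Nat.Tactic.RingSolver using (solve-∀)
open import Data.Fin using (toℕ)
open import Data.Fin.Properties using (toℕ<n)
open import Data.List using (_∷_; filter)
import Data.List.Relation.Unary.All as All
open import Data.Sum using (_⊎_; inj₁; inj₂)
import Data.Sum as Sum
open import Data.Empty using (⊥-elim)
open import Relation.Nullary using (Dec; yes; no)
open import Relation.Unary using (Decidable)
open import Relation.Binary.PropositionalEquality using (refl; sym; trans; cong; cong₂; subst)

𝟙 : ∀ {p} {Q : Set p} → Dec Q → ℕ
𝟙 (yes _) = 1
𝟙 (no _)  = 0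

𝟙-yes : ∀ {p} {Q : Set p} (d : Dec Q) → Q → 1 ≤ 𝟙 d
𝟙-yes (yes _) _ = ≤-refl
𝟙-yes (no ¬q) q = ⊥-elim (¬q q)

length-filter-∷ : ∀ {a p} {A : Set a} {Q : A → Set p} (Q? : Decidable Q) x xs →
  length (filter Q? (x ∷ xs)) ≡ 𝟙 (Q? x) + length (filter Q? xs)
length-filter-∷ Q? x xs with Q? x
... | yes _ = refl
... | no _  = refl

∑< : ℕ → (ℕ → ℕ) → ℕ
∑< zero    f = 0
∑< (suc n) f = f n + ∑< n f

∑<-cong : ∀ n (f g : ℕ → ℕ) → (∀ k → f k ≡ g k) → ∑< n f ≡ ∑< n g
∑<-cong zero    f g f≡g = refl
∑<-cong (suc n) f g f≡g = cong₂ _+_ (f≡g n) (∑<-cong n f g f≡g)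

∑<-+ : ∀ n (f g : ℕ → ℕ) → ∑< n (λ k → f k + g k) ≡ ∑< n f + ∑< n g
∑<-+ zero    f g = refl
∑<-+ (suc n) f g = trans (cong (f n + g n +_) (∑<-+ n f g)) (interchange (f n) (g n) _ _)
  where
  interchange : ∀ a b c d → (a + b) + (c + d) ≡ (a + c) + (b + d)
  interchange = solve-∀

∑<-*ˡ : ∀ n c (f : ℕ → ℕ) → ∑< n (λ k → c * f k) ≡ c * ∑< n f
∑<-*ˡ zero    c f = sym (*-zeroʳ c)
∑<-*ˡ (suc n) c f = trans (cong (c * f n +_) (∑<-*ˡ n c f)) (sym (*-distribˡ-+ c (f n) (∑< n f)))

∑<-const : ∀ n c → ∑< n (λ _ → c) ≡ n * c
∑<-const zero    c = refl
∑<-const (suc n) c = cong (c +_) (∑<-const n c)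

∑<-mono : ∀ n (f g : ℕ → ℕ) → (∀ k → k < n → f k ≤ g k) → ∑< n f ≤ ∑< n g
∑<-mono zero    f g f≤g = z≤n
∑<-mono (suc n) f g f≤g =
  +-mono-≤ (f≤g n (n<1+n n)) (∑<-mono n f g (λ k k<n → f≤g k (m<n⇒m<1+n k<n)))

term≤∑< : ∀ n (f : ℕ → ℕ) k → k < n → f k ≤ ∑< n f
term≤∑< (suc n) f k k<1+n with m<1+n⇒m<n∨m≡n k<1+n
... | inj₂ refl = m≤m+n (f k) _
... | inj₁ k<n  = ≤-trans (term≤∑< n f k k<n) (m≤n+m _ (f n))

∑<-𝟙-≡ : ∀ n a → ∑< n (λ k → 𝟙 (k ≟ a)) ≤ 1
∑<-𝟙-≡ zero    a = z≤n
∑<-𝟙-≡ (suc n) a with n ≟ a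
... | no _     = ∑<-𝟙-≡ n a
... | yes refl = +-monoʳ-≤ 1 (≤-reflexive (none-below n ≤-refl))
  where
  none-below : ∀ i → i ≤ n → ∑< i (λ k → 𝟙 (k ≟ n)) ≡ 0
  none-below zero    _     = refl
  none-below (suc i) 1+i≤n with i ≟ n
  ... | yes refl = ⊥-elim (<-irrefl refl 1+i≤n)
  ... | no _     = none-below i (≤-trans (n≤1+n i) 1+i≤n)

∑<-𝟙-three : ∀ n {p} {Q : ℕ → Set p} (Q? : ∀ k → Dec (Q k)) a b c →
  (∀ k → k < n → Q k → k ≡ a ⊎ k ≡ b ⊎ k ≡ c) → ∑< n (λ k → 𝟙 (Q? k)) ≤ 3
∑<-𝟙-three n Q? a b c only = begin
  ∑< n (λ k → 𝟙 (Q? k))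
    ≤⟨ ∑<-mono n _ _ pointwise ⟩
  ∑< n (λ k → 𝟙 (k ≟ a) + (𝟙 (k ≟ b) + 𝟙 (k ≟ c)))
    ≡⟨ ∑<-+ n _ _ ⟩
  ∑< n (λ k → 𝟙 (k ≟ a)) + ∑< n (λ k → 𝟙 (k ≟ b) + 𝟙 (k ≟ c))
    ≡⟨ cong (∑< n _ +_) (∑<-+ n _ _) ⟩
  ∑< n (λ k → 𝟙 (k ≟ a)) + (∑< n (λ k → 𝟙 (k ≟ b)) + ∑< n (λ k → 𝟙 (k ≟ c)))
    ≤⟨ +-mono-≤ (∑<-𝟙-≡ n a) (+-mono-≤ (∑<-𝟙-≡ n b) (∑<-𝟙-≡ n c)) ⟩
  3 ∎
  where
  open ≤-Reasoning
  pointwise : ∀ k → k < n → 𝟙 (Q? k) ≤ 𝟙 (k ≟ a) + (𝟙 (k ≟ b) + 𝟙 (k ≟ c))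
  pointwise k k<n with Q? k
  ... | no _  = z≤n
  ... | yes q with only k k<n q
  ...   | inj₁ k≡a        = ≤-trans (𝟙-yes (k ≟ a) k≡a) (m≤m+n _ _)
  ...   | inj₂ (inj₁ k≡b) = ≤-trans (𝟙-yes (k ≟ b) k≡b)
                              (≤-trans (m≤m+n _ (𝟙 (k ≟ c))) (m≤n+m _ (𝟙 (k ≟ a))))
  ...   | inj₂ (inj₂ k≡c) = ≤-trans (𝟙-yes (k ≟ c) k≡c)
                              (≤-trans (m≤n+m _ (𝟙 (k ≟ b))) (m≤n+m _ (𝟙 (k ≟ a))))

averaging : ∀ n (a b : ℕ → ℕ) → ∑< (suc n) b ≤ ∑< (suc n) a →
  Σ ℕ λ k → k < suc n × b k ≤ a k
averaging zero    a b b≤a = 0 , z<s , +-cancelʳ-≤ 0 (b 0) (a 0) b≤a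
averaging (suc n) a b b≤a with b (suc n) ≤? a (suc n)
... | yes last≤ = suc n , n<1+n (suc n) , last≤
... | no last≰ with averaging n a b (rest-≤ (≰⇒> last≰) b≤a)
  where
  rest-≤ : ∀ {u v x y} → u < v → v + x ≤ u + y → x ≤ y
  rest-≤ u<v le = ≮⇒≥ (λ y<x → <⇒≱ (+-mono-< u<v y<x) le)
...   | k , k<1+n , bk≤ak = k , m<n⇒m<1+n k<1+n , bk≤ak

∑<-filter-∷ : ∀ {a p} {A : Set a} n {D : ℕ → A → Set p} (D? : ∀ k → Decidable (D k)) x xs →
  ∑< n (λ k → length (filter (D? k) (x ∷ xs)))
    ≡ ∑< n (λ k → 𝟙 (D? k x)) + ∑< n (λ k → length (filter (D? k) xs))
∑<-filter-∷ n D? x xs =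
  trans (∑<-cong n _ _ (λ k → length-filter-∷ (D? k) x xs)) (∑<-+ n _ _)

covering-count : ∀ {a p} {A : Set a} n {D : ℕ → A → Set p} (D? : ∀ k → Decidable (D k))
  (xs : List A) → All (λ x → Σ ℕ λ k → k < n × D k x) xs →
  length xs ≤ ∑< n (λ k → length (filter (D? k) xs))
covering-count n D? []       _ = z≤n
covering-count n D? (x ∷ xs) ((k , k<n , Dkx) All.∷ covered) = begin
  1 + length xs
    ≤⟨ +-mono-≤ (≤-trans (𝟙-yes (D? k x) Dkx) (term≤∑< n _ k k<n))
                (covering-count n D? xs covered) ⟩
  ∑< n (λ k → 𝟙 (D? k x)) + ∑< n (λ k → length (filter (D? k) xs))
    ≡⟨ ∑<-filter-∷ n D? x xs ⟨
  ∑< n (λ k → length (filter (D? k) (x ∷ xs))) ∎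
  where open ≤-Reasoning

multiplicity-count : ∀ {a p} {A : Set a} n {D : ℕ → A → Set p} (D? : ∀ k → Decidable (D k))
  c → (∀ x → ∑< n (λ k → 𝟙 (D? k x)) ≤ c) →
  (xs : List A) → ∑< n (λ k → length (filter (D? k) xs)) ≤ c * length xs
multiplicity-count n D? c bounded [] =
  ≤-reflexive (trans (∑<-const n 0) (trans (*-zeroʳ n) (sym (*-zeroʳ c))))
multiplicity-count n D? c bounded (x ∷ xs) = begin
  ∑< n (λ k → length (filter (D? k) (x ∷ xs)))
    ≡⟨ ∑<-filter-∷ n D? x xs ⟩
  ∑< n (λ k → 𝟙 (D? k x)) + ∑< n (λ k → length (filter (D? k) xs))
    ≤⟨ +-mono-≤ (bounded x) (multiplicity-count n D? c bounded xs) ⟩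
  c + c * length xs
    ≡⟨ *-suc c (length xs) ⟨
  c * length (x ∷ xs) ∎
  where open ≤-Reasoning

balanced⇒bounds : ∀ m L Pn Cn c p .{{_ : NonZero m}} .{{_ : NonZero Pn}} →
  Pn * (L * Cn) + (4 * m * Cn) * p ≤ (16 * m * Pn) * c →
  (L * Cn ≤ (16 * m) * c) × (p * Cn ≤ (4 * Pn) * c)
balanced⇒bounds m L Pn Cn c p balanced = arcs-bound , positions-bound
  where
  instance
    4m≢0 : NonZero (4 * m)
    4m≢0 = m*n≢0 4 m

  as-arcs : ∀ m Pn c → (16 * m * Pn) * c ≡ Pn * ((16 * m) * c)
  as-arcs = solve-∀
  as-positionsˡ : ∀ m Cn p → (4 * m * Cn) * p ≡ (4 * m) * (p * Cn)
  as-positionsˡ = solve-∀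
  as-positionsʳ : ∀ m Pn c → (16 * m * Pn) * c ≡ (4 * m) * ((4 * Pn) * c)
  as-positionsʳ = solve-∀

  arcs-bound : L * Cn ≤ (16 * m) * c
  arcs-bound = *-cancelˡ-≤ Pn (begin
    Pn * (L * Cn)                     ≤⟨ m≤m+n _ _ ⟩
    Pn * (L * Cn) + (4 * m * Cn) * p  ≤⟨ balanced ⟩
    (16 * m * Pn) * c                 ≡⟨ as-arcs m Pn c ⟩
    Pn * ((16 * m) * c)               ∎)
    where open ≤-Reasoning

  positions-bound : p * Cn ≤ (4 * Pn) * c
  positions-bound = *-cancelˡ-≤ (4 * m) (begin
    (4 * m) * (p * Cn)                ≡⟨ as-positionsˡ m Cn p ⟨
    (4 * m * Cn) * p                  ≤⟨ m≤n+m _ _ ⟩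
    Pn * (L * Cn) + (4 * m * Cn) * p  ≤⟨ balanced ⟩
    (16 * m * Pn) * c                 ≡⟨ as-positionsʳ m Pn c ⟩
    (4 * m) * ((4 * Pn) * c)          ∎)
    where open ≤-Reasoning

-- Given n ≥ 1 windows of length L with n·L ≤ 2m, arc
-- counts c k covering all Cn arcs and position counts p k covering the Pn
-- positions at most three times, the total demand is at most 14·m·Pn·Cn, below
-- the total supply 16·m·Pn·Cn, so some window k has both
--   L·Cn ≤ 16m·c k   and   p k·Cn ≤ 4Pn·c k.
balanced-window : ∀ n (c p : ℕ → ℕ) m L Pn Cn .{{_ : NonZero m}} .{{_ : NonZero Pn}} →
  0 < n → n * L ≤ 2 * m → Cn ≤ ∑< n c → ∑< n p ≤ 3 * Pn →
  Σ ℕ λ k → k < n × (L * Cn ≤ (16 * m) * c k) × (p k * Cn ≤ (4 * Pn) * c k)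
balanced-window (suc n) c p m L Pn Cn _ nL≤2m Cn≤∑c ∑p≤3Pn =
  map₂ (map₂ (balanced⇒bounds m L Pn Cn _ _)) (averaging n supply demand total)
  where
  supply demand : ℕ → ℕ
  supply k = (16 * m * Pn) * c k
  demand k = Pn * (L * Cn) + (4 * m * Cn) * p k

  regroup : ∀ n L Pn Cn → n * (Pn * (L * Cn)) ≡ (n * L) * (Pn * Cn)
  regroup = solve-∀
  collect : ∀ m Pn Cn → (2 * m) * (Pn * Cn) + (4 * m * Cn) * (3 * Pn) ≡ 14 * m * Pn * Cn
  collect = solve-∀

  total : ∑< (suc n) demand ≤ ∑< (suc n) supply
  total = begin
    ∑< (suc n) demand
      ≡⟨ ∑<-+ (suc n) (λ _ → Pn * (L * Cn)) (λ k → (4 * m * Cn) * p k) ⟩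
    ∑< (suc n) (λ _ → Pn * (L * Cn)) + ∑< (suc n) (λ k → (4 * m * Cn) * p k)
      ≡⟨ cong₂ _+_ (trans (∑<-const (suc n) _) (regroup (suc n) L Pn Cn))
                   (∑<-*ˡ (suc n) (4 * m * Cn) p) ⟩
    (suc n * L) * (Pn * Cn) + (4 * m * Cn) * ∑< (suc n) p
      ≤⟨ +-mono-≤ (*-monoˡ-≤ (Pn * Cn) nL≤2m) (*-monoʳ-≤ (4 * m * Cn) ∑p≤3Pn) ⟩
    (2 * m) * (Pn * Cn) + (4 * m * Cn) * (3 * Pn)
      ≡⟨ collect m Pn Cn ⟩
    14 * m * Pn * Cn
      ≤⟨ *-monoˡ-≤ Cn (*-monoˡ-≤ Pn (*-monoˡ-≤ m (m≤m+n 14 2))) ⟩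
    (16 * m * Pn) * Cn
      ≤⟨ *-monoʳ-≤ (16 * m * Pn) Cn≤∑c ⟩
    (16 * m * Pn) * ∑< (suc n) c
      ≡⟨ ∑<-*ˡ (suc n) (16 * m * Pn) c ⟨
    ∑< (suc n) supply ∎
    where open ≤-Reasoning

below-next-block : ∀ x ℓ .{{_ : NonZero ℓ}} → x < suc (x / ℓ) * ℓ
below-next-block x ℓ = begin-strict
  x                   ≡⟨ m≡m%n+[m/n]*n x ℓ ⟩
  x % ℓ + x / ℓ * ℓ   <⟨ +-monoˡ-< (x / ℓ * ℓ) (m%n<n x ℓ) ⟩
  ℓ + x / ℓ * ℓ       ∎
  where open ≤-Reasoning

block-≥ : ∀ {k x} ℓ .{{_ : NonZero ℓ}} → k * ℓ ≤ x → k ≤ x / ℓ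
block-≥ {k} {x} ℓ kℓ≤x = subst (_≤ x / ℓ) (m*n/n≡m k ℓ) (/-monoˡ-≤ ℓ kℓ≤x)

two-blocks : ∀ k ℓ → k * ℓ + 2 * ℓ ≡ suc (suc k) * ℓ
two-blocks = solve-∀

block-neighbours : ∀ {k x} ℓ .{{_ : NonZero ℓ}} → k * ℓ ≤ x → x < suc (suc k) * ℓ →
  k ≡ x / ℓ ⊎ k ≡ pred (x / ℓ)
block-neighbours {k} {x} ℓ kℓ≤x x<[2+k]ℓ with m≤n⇒m<n∨m≡n (block-≥ ℓ kℓ≤x)
... | inj₂ k≡a = inj₁ k≡a
... | inj₁ k<a = inj₂ (cong pred (≤-antisym k<a (m<1+n⇒m≤n (m<n*o⇒m/o<n x<[2+k]ℓ))))

-- The q = ⌊m/ℓ⌋ windows of length 2ℓ inside {0,…,m-1}: window k starts at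
-- min (k·ℓ , m − 2ℓ), so all windows but the last are aligned to blocks and
-- the last one is flush with the end of the sequence.
module Windows (m ℓ : ℕ) .{{_ : NonZero ℓ}} (2ℓ≤m : 2 * ℓ ≤ m) where

  q : ℕ
  q = m / ℓ

  last : ℕ
  last = pred q

  2≤q : 2 ≤ q
  2≤q = block-≥ ℓ 2ℓ≤m

  q≡1+last : suc last ≡ q
  q≡1+last = suc-pred q {{>-nonZero (≤-trans (s≤s z≤n) 2≤q)}}

  last<q : last < q
  last<q = ≤-reflexive q≡1+last

  m-nonZero : NonZero m
  m-nonZero = >-nonZero (<-≤-trans (>-nonZero⁻¹ ℓ) (≤-trans (m≤m+n ℓ _) 2ℓ≤m))

  windows-length : q * (2 * ℓ) ≤ 2 * m
  windows-length = begin
    q * (2 * ℓ)   ≡⟨ *-comm q (2 * ℓ) ⟩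
    2 * ℓ * q     ≡⟨ *-assoc 2 ℓ q ⟩
    2 * (ℓ * q)   ≡⟨ cong (2 *_) (*-comm ℓ q) ⟩
    2 * (q * ℓ)   ≤⟨ *-monoʳ-≤ 2 (m/n*n≤m m ℓ) ⟩
    2 * m         ∎
    where open ≤-Reasoning

  windowStart : ℕ → ℕ
  windowStart k = k * ℓ ⊓ (m ∸ 2 * ℓ)

  windowStart≤ : ∀ k → windowStart k ≤ k * ℓ
  windowStart≤ k = m⊓n≤m (k * ℓ) (m ∸ 2 * ℓ)

  window-fits : ∀ k → windowStart k + 2 * ℓ ≤ m
  window-fits k = ≤-trans (+-monoˡ-≤ (2 * ℓ) (m⊓n≤n (k * ℓ) (m ∸ 2 * ℓ)))
                          (≤-reflexive (m∸n+n≡m 2ℓ≤m))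

  window-end : ∀ k {x} → x < k * ℓ + 2 * ℓ → x < m → x < windowStart k + 2 * ℓ
  window-end k {x} x<kℓ+2ℓ x<m = begin-strict
    x                                          <⟨ ⊓-glb x<kℓ+2ℓ x<m ⟩
    (k * ℓ + 2 * ℓ) ⊓ m                        ≡⟨ cong ((k * ℓ + 2 * ℓ) ⊓_) (m∸n+n≡m 2ℓ≤m) ⟨
    (k * ℓ + 2 * ℓ) ⊓ (m ∸ 2 * ℓ + 2 * ℓ)      ≡⟨ +-distribʳ-⊓ (2 * ℓ) (k * ℓ) (m ∸ 2 * ℓ) ⟨
    windowStart k + 2 * ℓ                      ∎
    where open ≤-Reasoning

  windowStart-aligned : ∀ k → suc k < q → windowStart k ≡ k * ℓ
  windowStart-aligned k 1+k<q = m≤n⇒m⊓n≡m (m+n≤o⇒m≤o∸n (k * ℓ) fits)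
    where
    fits : k * ℓ + 2 * ℓ ≤ m
    fits = ≤-trans (≤-reflexive (two-blocks k ℓ)) (≤-trans (*-monoˡ-≤ ℓ 1+k<q) (m/n*n≤m m ℓ))

  last-window-end : m < last * ℓ + 2 * ℓ
  last-window-end = begin-strict
    m                    <⟨ below-next-block m ℓ ⟩
    suc q * ℓ            ≡⟨ cong (λ n → suc n * ℓ) q≡1+last ⟨
    suc (suc last) * ℓ   ≡⟨ two-blocks last ℓ ⟨
    last * ℓ + 2 * ℓ     ∎
    where open ≤-Reasoning

  contained : ∀ (i j : Fin m) k → toℕ i < toℕ j →
    windowStart k ≤ toℕ i → toℕ j < k * ℓ + 2 * ℓ → ContainedIn (windowStart k) (2 * ℓ) (i , j)
  contained i j k i<j s≤i j<kℓ+2ℓ =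
    (s≤i , <-trans i<j j<end) , (≤-trans s≤i (<⇒≤ i<j) , j<end)
    where
    j<end : toℕ j < windowStart k + 2 * ℓ
    j<end = window-end k j<kℓ+2ℓ (toℕ<n j)

  -- Every arc of length ≤ ℓ lies in some window: the one starting at the
  -- block of its left end, or the last window if that block is too far right.
  arc-covered : ∀ (i j : Fin m) → toℕ i < toℕ j → ArcLen≤ (i , j) ℓ →
    Σ ℕ λ k → k < q × ContainedIn (windowStart k) (2 * ℓ) (i , j)
  arc-covered i j i<j len with toℕ i / ℓ <? q
  ... | yes a<q = toℕ i / ℓ , a<q ,
      contained i j (toℕ i / ℓ) i<j
        (≤-trans (windowStart≤ (toℕ i / ℓ)) (m/n*n≤m (toℕ i) ℓ)) j<aℓ+2ℓ
    where
    regroup : ∀ a ℓ → (ℓ + a * ℓ) + ℓ ≡ a * ℓ + 2 * ℓ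
    regroup = solve-∀
    j<aℓ+2ℓ : toℕ j < toℕ i / ℓ * ℓ + 2 * ℓ
    j<aℓ+2ℓ = begin-strict
      toℕ j                            <⟨ subst (_≤ toℕ i + ℓ) (+-comm (toℕ j) 1) len ⟩
      toℕ i + ℓ                        <⟨ +-monoˡ-< ℓ (below-next-block (toℕ i) ℓ) ⟩
      (ℓ + toℕ i / ℓ * ℓ) + ℓ          ≡⟨ regroup (toℕ i / ℓ) ℓ ⟩
      toℕ i / ℓ * ℓ + 2 * ℓ            ∎
      where open ≤-Reasoning
  ... | no a≮q = last , last<q ,
      contained i j last i<j windowStart≤i (<-trans (toℕ<n j) last-window-end)
    where
    windowStart≤i : windowStart last ≤ toℕ i
    windowStart≤i = begin
      windowStart last   ≤⟨ windowStart≤ last ⟩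
      last * ℓ           ≤⟨ *-monoˡ-≤ ℓ (≤-trans (pred[n]≤n {q}) (≮⇒≥ a≮q)) ⟩
      toℕ i / ℓ * ℓ      ≤⟨ m/n*n≤m (toℕ i) ℓ ⟩
      toℕ i              ∎
      where open ≤-Reasoning

  window-indices : ∀ (x : Fin m) k → k < q → InInterval (windowStart k) (2 * ℓ) x →
    k ≡ toℕ x / ℓ ⊎ k ≡ pred (toℕ x / ℓ) ⊎ k ≡ last
  window-indices x k k<q (s≤x , x<end) with suc k <? q
  ... | no 1+k≮q = inj₂ (inj₂ (cong pred (≤-antisym k<q (≮⇒≥ 1+k≮q))))
  ... | yes 1+k<q = Sum.map₂ inj₁ (block-neighbours ℓ (subst (_≤ toℕ x) aligned s≤x)
                     (subst (toℕ x <_) (trans (cong (_+ 2 * ℓ) aligned) (two-blocks k ℓ)) x<end))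
    where
    aligned : windowStart k ≡ k * ℓ
    aligned = windowStart-aligned k 1+k<q

  position-multiplicity : ∀ (x : Fin m) →
    ∑< q (λ k → 𝟙 (inInterval? (windowStart k) (2 * ℓ) x)) ≤ 3
  position-multiplicity x =
    ∑<-𝟙-three q (λ k → inInterval? (windowStart k) (2 * ℓ) x) _ _ _ (window-indices x)

lemma4p6 : ∀ {a} {A : Set a} (m : ℕ) (H : Fin m → A)
    (P : List (Fin m)) (C : List (Fin m × Fin m)) (ℓ : ℕ) →
    Unique P → ¬ (P ≡ []) →
    Unique C → ¬ (C ≡ []) → All (IsArc H) C →
    All (λ α → ArcLen≤ α ℓ) C →
    1 ≤ ℓ → 2 * ℓ ≤ m →
    Σ ℕ (λ s → (s + 2 * ℓ ≤ m) ×
    ((2 * ℓ) * length C ≤ (16 * m) * countContained s (2 * ℓ) C) ×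
    (countIn s (2 * ℓ) P * length C ≤ (4 * length P) * countContained s (2 * ℓ) C))
lemma4p6 m H [] C ℓ _ P≢[] _ _ _ _ _ _ = ⊥-elim (P≢[] refl)
lemma4p6 m H P@(_ ∷ _) C ℓ _ _ _ _ arcs lengths 1≤ℓ 2ℓ≤m =
  let (k , _ , bounds) = balanced-window q arcsIn positionsIn m (2 * ℓ) (length P) (length C)
                           {{m-nonZero}} (<-trans z<s 2≤q) windows-length arcs-covered
                           positions-covered
  in windowStart k , window-fits k , bounds
  where
  instance
    ℓ-nonZero : NonZero ℓ
    ℓ-nonZero = >-nonZero 1≤ℓ
  open Windows m ℓ 2ℓ≤m

  arcsIn positionsIn : ℕ → ℕ
  arcsIn k = countContained (windowStart k) (2 * ℓ) C
  positionsIn k = countIn (windowStart k) (2 * ℓ) P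

  arcs-covered : length C ≤ ∑< q arcsIn
  arcs-covered = covering-count q (λ k → containedIn? (windowStart k) (2 * ℓ)) C
    (All.zipWith (λ { ((i<j , _) , len) → arc-covered _ _ i<j len }) (arcs , lengths))

  positions-covered : ∑< q positionsIn ≤ 3 * length P
  positions-covered =
    multiplicity-count q (λ k → inInterval? (windowStart k) (2 * ℓ)) 3 position-multiplicity P
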